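{- If $G$ is a randomly $k$-dimensional graph of order $n$, then $$\binom{n}{2}(n-k+1)\leq e(R(G))\leq n\left(\binom{n}{2}-k+1\right).$$
   Context: All graphs are finite, simple and connected; $e(H)$ denotes the number of edges of a graph $H$. For an ordered set $W=\{w_1,\dots,w_k\}\subseteq V(G)$ and $v\in V(G)$, $r(v|W)=(d(v,w_1),\dots,d(v,w_k))$, where $d$ denotes graph distance. $W$ is a resolving set if distinct vertices have distinct representations with respect to $W$; a basis is a minimum-size resolving set and its size is the metric dimension $\beta(G)$. $G$ is randomly $k$-dimensional if $\beta(G)=k$ and every $k$-subset of $V(G)$ is a basis of $G$. Let $V_p$ be the set of all $\binom{n}{2}$ unordered pairs of distinct vertices of $G$. A vertex $v$ resolves a pair $\{x,y\}$ if $d(v,x)\neq d(v,y)$. The resolving graph $R(G)$ is the bipartite graph with parts $V(G)$ and $V_p$ in which $v\in V(G)$ is adjacent to $\{x,y\}\in V_p$ if and only if $v$ resolves $\{x,y\}$. -}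

module Defs where

open import Data.Bool using (Bool; true; false; _∧_; _∨_; not; if_then_else_)
open import Data.Nat using (ℕ; zero; suc; _≡ᵇ_; _<ᵇ_)
open import Data.Fin using (Fin; toℕ)
open import Data.Fin.Subset using (Subset; _∈_; ∣_∣)
open import Data.Bool.ListAction using (any)
open import Data.List using (List; allFin; filter; length; concatMap; map)
open import Data.Product using (_×_; _,_; ∃)
open import Relation.Binary.PropositionalEquality using (_≡_)
open import Relation.Nullary using (¬_)
open import Data.Bool.Properties using (T?)

record Graph (n : ℕ) : Set where
  field
    adj   : Fin n → Fin n → Bool
    sym   : ∀ u v → adj u v ≡ adj v u
    irrefl : ∀ u → adj u u ≡ false
open Graph public

module _ {n : ℕ} (G : Graph n) where

  reach : ℕ → Fin n → Fin n → Bool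
  reach zero    u v = toℕ u ≡ᵇ toℕ v
  reach (suc k) u v = reach k u v ∨ any (λ w → reach k u w ∧ adj G w v) (allFin n)

  Connected : Set
  Connected = ∀ u v → ∃ λ k → reach k u v ≡ true

-- least i < b with p i = true (returns b if there is none)
least : (ℕ → Bool) → ℕ → ℕ
least p zero    = zero
least p (suc b) = if p zero then zero else suc (least (λ i → p (suc i)) b)

module _ {n : ℕ} (G : Graph n) where

  -- graph distance: least k such that v is reachable from u by a walk of
  -- length ≤ k (in a connected graph on n vertices some k < n works)
  dist : Fin n → Fin n → ℕ
  dist u v = least (λ k → reach G k u v) n

  Resolving : Subset n → Set
  Resolving W = ∀ x y → (∀ w → w ∈ W → dist w x ≡ dist w y) → x ≡ y

  MetricDim : ℕ → Set
  MetricDim k = (∃ λ W → Resolving W × ∣ W ∣ ≡ k)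
              × (∀ W → Resolving W → k Data.Nat.≤ ∣ W ∣)

  RandomlyDim : ℕ → Set
  RandomlyDim k = MetricDim k × (∀ W → ∣ W ∣ ≡ k → Resolving W)

  resolves : Fin n → Fin n → Fin n → Bool
  resolves v x y = not (dist v x ≡ᵇ dist v y)

  -- number of edges of the resolving graph R(G): pairs (v , {x,y}) with
  -- x ≠ y (encoded as toℕ x < toℕ y) such that v resolves {x,y}
  eR : ℕ
  eR = length (filter (λ t → T? (edge t)) triples)
    where
      triples : List (Fin n × Fin n × Fin n)
      triples = concatMap (λ v → concatMap (λ x → map (λ y → v , x , y) (allFin n)) (allFin n)) (allFin n)
      edge : Fin n × Fin n × Fin n → Bool
      edge (v , x , y) = (toℕ x <ᵇ toℕ y) ∧ resolves v x y

-- e(R(G)) counts the incidences (v , {x,y}) with v resolving {x,y}.  We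
-- count them in two ways, once pair by pair and once vertex by vertex.
--
--  * Lower bound (pairs).  Fix a pair {x,y}.  The vertices that do not
--    resolve it form a set N which is not resolving, so |N| < k: otherwise a
--    k-subset of N would be a basis (G is randomly k-dimensional) failing to
--    resolve {x,y}.  Hence at least n - k + 1 vertices resolve each pair.
--  * Upper bound (vertices).  Fix a vertex v.  Greedily grow a set W ∋ v:
--    while |W| < k, W is not resolving (β(G) = k), so some pair {x,y} is
--    unresolved by all of W, in particular by v; adding a vertex resolving
--    {x,y} makes W separate one more such pair.  So at least k - 1 pairs are
--    unresolved by v, and v resolves at most C(n,2) - k + 1 pairs.
--    This half only uses β(G) = k.
module Submission where

open import Defs hiding (sym)
open import Data.Bool using (Bool; true; false; _∧_; _∨_; not; T)
open import Data.Bool.Properties using (T?; T-≡; T-∧; not-involutive)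
open import Data.Fin using (Fin; toℕ; zero; suc)
open import Data.Fin.Properties using (any?; all?; toℕ-injective) renaming (<⇒≢ to <⇒≢ᶠ)
open import Data.Fin.Subset using (Subset; _∈_; ∣_∣)
open import Data.Fin.Subset.Properties using (∣p∣≤n)
open import Data.List using (List; []; _∷_; _++_; allFin; filter; length; concatMap; map; tabulate)
open import Data.List.Properties using (length-++; filter-++)
open import Data.Nat using (ℕ; zero; suc; _+_; _*_; _∸_; _≤_; _<_; z≤n; s≤s; _≡ᵇ_; _<ᵇ_)
open import Data.Nat.Combinatorics using (_C_; nC1≡n; nCk+nC[k+1]≡[n+1]C[k+1])
open import Data.Nat.ListAction using () renaming (sum to sumList)
open import Data.Nat.Properties
open import Data.Product using (_×_; _,_; ∃; ∃₂; proj₁; proj₂)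
open import Data.Unit using (tt)
import Data.Vec as Vec
import Data.Vec.Properties as Vec
open import Function using (_∘_; id; case_of_; _⇔_; mk⇔; Equivalence)
open import Relation.Binary.PropositionalEquality
  using (_≡_; _≢_; refl; sym; trans; cong; cong₂; subst; module ≡-Reasoning)
open import Relation.Nullary using (¬_; Dec; yes; no; contradiction)
open import Relation.Binary.Definitions using (tri<; tri≈; tri>)
open import Relation.Nullary.Decidable using (isNo; _→-dec_; _×-dec_)

open import Algebra.Properties.Semiring.Sum +-*-semiring
  using (sum; sum-syntax; ∑-distrib-+; ∑-comm; *-distribʳ-sum; sum-cong-≗)

∑-const : ∀ n c → ∑[ i < n ] c ≡ n * c
∑-const zero    c = refl
∑-const (suc n) c = cong (c +_) (∑-const n c)

∑-mono-≤ : ∀ {n} {f g : Fin n → ℕ} → (∀ i → f i ≤ g i) → sum f ≤ sum g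
∑-mono-≤ {zero}  f≤g = z≤n
∑-mono-≤ {suc n} f≤g = +-mono-≤ (f≤g zero) (∑-mono-≤ (f≤g ∘ suc))

∑-mono-< : ∀ {n} {f g : Fin n → ℕ} → (∀ i → f i ≤ g i) → ∀ j → f j < g j → sum f < sum g
∑-mono-< f≤g zero    fj<gj = +-mono-<-≤ fj<gj (∑-mono-≤ (f≤g ∘ suc))
∑-mono-< f≤g (suc j) fj<gj = +-mono-≤-< (f≤g zero) (∑-mono-< (f≤g ∘ suc) j fj<gj)

∑-rotate : ∀ {n} (F : Fin n → Fin n → Fin n → ℕ) →
  ∑[ v < n ] ∑[ x < n ] ∑[ y < n ] F v x y ≡ ∑[ x < n ] ∑[ y < n ] ∑[ v < n ] F v x y
∑-rotate F = trans (∑-comm (λ v x → ∑[ y < _ ] F v x y)) (sum-cong-≗ (λ x → ∑-comm (λ v y → F v x y)))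

⟦_⟧ : Bool → ℕ
⟦ true  ⟧ = 1
⟦ false ⟧ = 0

T-not⇒¬T : ∀ {b} → T (not b) → ¬ T b
T-not⇒¬T {false} _ ()

¬T⇒T-not : ∀ {b} → ¬ T b → T (not b)
¬T⇒T-not {true}  ¬b = ¬b tt
¬T⇒T-not {false} _  = tt

⟦⟧-false : ∀ {b} → ¬ T b → ⟦ b ⟧ ≡ 0
⟦⟧-false {true}  ¬b = contradiction tt ¬b
⟦⟧-false {false} _  = refl

⟦⟧-mono : ∀ {a b} → (T a → T b) → ⟦ a ⟧ ≤ ⟦ b ⟧
⟦⟧-mono {false}         _   = z≤n
⟦⟧-mono {true} {true}   _   = ≤-refl
⟦⟧-mono {true} {false} a⇒b = contradiction tt a⇒b

⟦⟧-strict : ∀ {a b} → ¬ T a → T b → ⟦ a ⟧ < ⟦ b ⟧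
⟦⟧-strict {true}          ¬a _ = contradiction tt ¬a
⟦⟧-strict {false} {true}  _  _ = ≤-refl

count : ∀ {n} → (Fin n → Bool) → ℕ
count p = ∑[ i < _ ] ⟦ p i ⟧

_⊑_ : ∀ {n} → (Fin n → Bool) → (Fin n → Bool) → Set
χ ⊑ p = ∀ w → T (χ w) → T (p w)

∅ : ∀ {n} → Fin n → Bool
∅ _ = false

count-∅ : ∀ n → count {n} ∅ ≡ 0
count-∅ n = trans (∑-const n 0) (*-zeroʳ n)

count-complement : ∀ {n} (p : Fin n → Bool) → count (not ∘ p) + count p ≡ n
count-complement {n} p = begin
  count (not ∘ p) + count p            ≡⟨ ∑-distrib-+ (λ i → ⟦ not (p i) ⟧) (λ i → ⟦ p i ⟧) ⟨
  ∑[ i < n ] (⟦ not (p i) ⟧ + ⟦ p i ⟧) ≡⟨ sum-cong-≗ (λ i → not+self (p i)) ⟩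
  ∑[ i < n ] 1                         ≡⟨ ∑-const n 1 ⟩
  n * 1                                ≡⟨ *-identityʳ n ⟩
  n                                    ∎
  where
  open ≡-Reasoning
  not+self : ∀ b → ⟦ not b ⟧ + ⟦ b ⟧ ≡ 1
  not+self true  = refl
  not+self false = refl

insert : ∀ {n} → Fin n → (Fin n → Bool) → Fin n → Bool
insert w χ u = (toℕ u ≡ᵇ toℕ w) ∨ χ u

∈-insert : ∀ {n} (w : Fin n) χ → T (insert w χ w)
∈-insert w χ with toℕ w ≡ᵇ toℕ w | ≡⇒≡ᵇ (toℕ w) (toℕ w) refl
... | true | _ = tt

⊑-insert : ∀ {n} (w : Fin n) χ → χ ⊑ insert w χ
⊑-insert w χ u χu with toℕ u ≡ᵇ toℕ w
... | true  = tt
... | false = χu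

count-insert : ∀ {n} (χ : Fin n → Bool) w → ¬ T (χ w) → count (insert w χ) ≡ suc (count χ)
count-insert χ zero    w∉χ = cong (λ m → suc (m + count (χ ∘ suc))) (sym (⟦⟧-false w∉χ))
count-insert χ (suc w) w∉χ =
  trans (cong (⟦ χ zero ⟧ +_) (count-insert (χ ∘ suc) w w∉χ)) (+-suc ⟦ χ zero ⟧ (count (χ ∘ suc)))

pick : ∀ {n} k (p : Fin n → Bool) → k ≤ count p → ∃ λ χ → χ ⊑ p × count χ ≡ k
pick {n}     zero    p _ = ∅ , (λ _ ()) , count-∅ n
pick {suc n} (suc k) p k<count with p zero in p₀
... | true  with pick k (p ∘ suc) (≤-pred k<count)
...   | χ , χ⊑p , #χ = (λ { zero → true ; (suc i) → χ i })
                     , (λ { zero _ → subst T (sym p₀) tt ; (suc i) → χ⊑p i })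
                     , cong suc #χ
pick {suc n} (suc k) p k<count | false with pick (suc k) (p ∘ suc) k<count
...   | χ , χ⊑p , #χ = (λ { zero → false ; (suc i) → χ i })
                     , (λ { zero () ; (suc i) → χ⊑p i })
                     , #χ

-- Counting unordered pairs {x,y}, each represented once as x < y

_≺_ : ∀ {n} → Fin n → Fin n → Bool
x ≺ y = toℕ x <ᵇ toℕ y

pairCount : ∀ {n} → (Fin n → Fin n → Bool) → ℕ
pairCount {n} P = ∑[ x < n ] ∑[ y < n ] ⟦ x ≺ y ∧ P x y ⟧

numPairs : ℕ → ℕ
numPairs n = ∑[ x < n ] ∑[ y < n ] ⟦ x ≺ y ⟧

-- Splitting off the pairs containing the least vertex gives Pascal's rule.
numPairs≡nC2 : ∀ n → numPairs n ≡ n C 2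
numPairs≡nC2 zero    = refl
numPairs≡nC2 (suc n) = begin
  ∑[ y < n ] 1 + numPairs n ≡⟨ cong₂ _+_ (trans (∑-const n 1) (*-identityʳ n)) (numPairs≡nC2 n) ⟩
  n + n C 2                 ≡⟨ cong (_+ n C 2) (nC1≡n n) ⟨
  n C 1 + n C 2             ≡⟨ nCk+nC[k+1]≡[n+1]C[k+1] n 1 ⟩
  suc n C 2                 ∎
  where open ≡-Reasoning

pairCount-complement : ∀ {n} (P : Fin n → Fin n → Bool) →
  pairCount (λ x y → not (P x y)) + pairCount P ≡ numPairs n
pairCount-complement {n} P = begin
  pairCount (λ x y → not (P x y)) + pairCount P
    ≡⟨ ∑-distrib-+ (λ x → ∑[ y < n ] ⟦ x ≺ y ∧ not (P x y) ⟧) (λ x → ∑[ y < n ] ⟦ x ≺ y ∧ P x y ⟧) ⟨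
  ∑[ x < n ] (∑[ y < n ] ⟦ x ≺ y ∧ not (P x y) ⟧ + ∑[ y < n ] ⟦ x ≺ y ∧ P x y ⟧)
    ≡⟨ sum-cong-≗ (λ x → sym (∑-distrib-+ (λ y → ⟦ x ≺ y ∧ not (P x y) ⟧) (λ y → ⟦ x ≺ y ∧ P x y ⟧))) ⟩
  ∑[ x < n ] ∑[ y < n ] (⟦ x ≺ y ∧ not (P x y) ⟧ + ⟦ x ≺ y ∧ P x y ⟧)
    ≡⟨ sum-cong-≗ (λ x → sum-cong-≗ (λ y → split (x ≺ y) (P x y))) ⟩
  numPairs n ∎
  where
  open ≡-Reasoning
  split : ∀ a b → ⟦ a ∧ not b ⟧ + ⟦ a ∧ b ⟧ ≡ ⟦ a ⟧
  split false _     = refl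
  split true  true  = refl
  split true  false = refl

pairTerm-mono : ∀ {n} {P Q : Fin n → Fin n → Bool} → (∀ x y → T (P x y) → T (Q x y)) →
  ∀ x y → ⟦ x ≺ y ∧ P x y ⟧ ≤ ⟦ x ≺ y ∧ Q x y ⟧
pairTerm-mono P⇒Q x y = ⟦⟧-mono (∧-monoʳ (x ≺ y) (P⇒Q x y))
  where
  ∧-monoʳ : ∀ a {b c} → (T b → T c) → T (a ∧ b) → T (a ∧ c)
  ∧-monoʳ true b⇒c = b⇒c

pairCount-mono : ∀ {n} {P Q : Fin n → Fin n → Bool} → (∀ x y → T (P x y) → T (Q x y)) →
  pairCount P ≤ pairCount Q
pairCount-mono P⇒Q = ∑-mono-≤ (λ x → ∑-mono-≤ (pairTerm-mono P⇒Q x))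

pairCount-mono-< : ∀ {n} {P Q : Fin n → Fin n → Bool} → (∀ x y → T (P x y) → T (Q x y)) →
  ∀ x y → toℕ x < toℕ y → ¬ T (P x y) → T (Q x y) → pairCount P < pairCount Q
pairCount-mono-< {P = P} P⇒Q x y x<y ¬Pxy Qxy =
  ∑-mono-< (λ x′ → ∑-mono-≤ (pairTerm-mono P⇒Q x′)) x
    (∑-mono-< (pairTerm-mono P⇒Q x) y
      (⟦⟧-strict (¬Pxy ∘ proj₂ ∘ Equivalence.to T-∧) (Equivalence.from T-∧ (<⇒<ᵇ x<y , Qxy))))

incidences-lower : ∀ {n} (R : Fin n → Fin n → Fin n → Bool) c →
  (∀ x y → toℕ x < toℕ y → c ≤ count (λ v → R v x y)) →
  (n C 2) * c ≤ ∑[ v < n ] pairCount (R v)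
incidences-lower {n} R c many = begin
  (n C 2) * c
    ≡⟨ cong (_* c) (numPairs≡nC2 n) ⟨
  numPairs n * c
    ≡⟨ *-distribʳ-sum c (λ x → ∑[ y < n ] ⟦ x ≺ y ⟧) ⟩
  ∑[ x < n ] ((∑[ y < n ] ⟦ x ≺ y ⟧) * c)
    ≡⟨ sum-cong-≗ {n} (λ x → *-distribʳ-sum c (λ y → ⟦ x ≺ y ⟧)) ⟩
  ∑[ x < n ] ∑[ y < n ] (⟦ x ≺ y ⟧ * c)
    ≤⟨ ∑-mono-≤ (λ x → ∑-mono-≤ (λ y → hits (x ≺ y) (λ x≺y → many x y (<ᵇ⇒< _ _ x≺y)))) ⟩
  ∑[ x < n ] ∑[ y < n ] ∑[ v < n ] ⟦ x ≺ y ∧ R v x y ⟧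
    ≡⟨ ∑-rotate (λ v x y → ⟦ x ≺ y ∧ R v x y ⟧) ⟨
  ∑[ v < n ] pairCount (R v) ∎
  where
  open ≤-Reasoning
  hits : ∀ {x y} b → (T b → c ≤ count (λ v → R v x y)) → ⟦ b ⟧ * c ≤ ∑[ v < n ] ⟦ b ∧ R v x y ⟧
  hits false _    = z≤n
  hits true  c≤# = subst (_≤ _) (sym (+-identityʳ c)) (c≤# tt)

good-lower : ∀ {a b n k} → a + b ≡ n → suc a ≤ k → k ≤ n → n ∸ k + 1 ≤ b
good-lower {a} {b} {n} {k} a+b≡n a<k k≤n = subst (n ∸ k + 1 ≤_) n∸a≡b (m+n≤o⇒m≤o∸n (n ∸ k + 1) bound)
  where
  open ≤-Reasoning
  n∸a≡b : n ∸ a ≡ b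
  n∸a≡b = trans (cong (_∸ a) (sym a+b≡n)) (m+n∸m≡n a b)
  bound : n ∸ k + 1 + a ≤ n
  bound = begin
    n ∸ k + 1 + a   ≡⟨ +-assoc (n ∸ k) 1 a ⟩
    n ∸ k + suc a   ≤⟨ +-monoʳ-≤ (n ∸ k) a<k ⟩
    n ∸ k + k       ≡⟨ m∸n+n≡m k≤n ⟩
    n               ∎

good-upper : ∀ {h g P k} → h + g ≡ P → k ≤ suc h → g ≤ P ∸ k + 1
good-upper {h} {g} {P} {k} h+g≡P k≤1+h = subst (_≤ P ∸ k + 1) P∸h≡g (m≤n+o⇒m∸n≤o P h bound)
  where
  open ≤-Reasoning
  P∸h≡g : P ∸ h ≡ g
  P∸h≡g = trans (cong (_∸ h) (sym h+g≡P)) (m+n∸m≡n h g)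
  bound : P ≤ h + (P ∸ k + 1)
  bound = begin
    P                   ≤⟨ m≤n+m∸n P k ⟩
    k + (P ∸ k)         ≤⟨ +-monoˡ-≤ (P ∸ k) k≤1+h ⟩
    suc h + (P ∸ k)     ≡⟨ +-suc h (P ∸ k) ⟨
    h + suc (P ∸ k)     ≡⟨ cong (h +_) (+-comm 1 (P ∸ k)) ⟩
    h + (P ∸ k + 1)     ∎

below-all : ∀ {k h} → (∀ j → j < k → j ≤ h) → k ≤ suc h
below-all {zero}  _     = z≤n
below-all {suc j} bound = s≤s (bound j ≤-refl)

module _ {A : Set} (p : A → Bool) where

  #filter : List A → ℕ
  #filter xs = length (filter (λ t → T? (p t)) xs)

  #filter-concatMap : ∀ {B : Set} (F : B → List A) xs →
    #filter (concatMap F xs) ≡ sumList (map (#filter ∘ F) xs)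
  #filter-concatMap F []       = refl
  #filter-concatMap F (b ∷ bs) = begin
    #filter (F b ++ concatMap F bs)
      ≡⟨ cong length (filter-++ (λ t → T? (p t)) (F b) (concatMap F bs)) ⟩
    length (filter (λ t → T? (p t)) (F b) ++ filter (λ t → T? (p t)) (concatMap F bs))
      ≡⟨ length-++ (filter (λ t → T? (p t)) (F b)) ⟩
    #filter (F b) + #filter (concatMap F bs)
      ≡⟨ cong (#filter (F b) +_) (#filter-concatMap F bs) ⟩
    sumList (map (#filter ∘ F) (b ∷ bs)) ∎
    where open ≡-Reasoning

  #filter-map : ∀ {B : Set} (g : B → A) xs → #filter (map g xs) ≡ sumList (map (λ b → ⟦ p (g b) ⟧) xs)
  #filter-map g []       = refl
  #filter-map g (b ∷ bs) with p (g b)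
  ... | true  = cong suc (#filter-map g bs)
  ... | false = #filter-map g bs

-- Summing over the list allFin n = tabulate id is summing over Fin n.
sumList-allFin : ∀ {n} (f : Fin n → ℕ) → sumList (map f (allFin n)) ≡ ∑[ i < n ] f i
sumList-allFin f = go f id
  where
  go : ∀ {m} {A : Set} (f : A → ℕ) (g : Fin m → A) → sumList (map f (tabulate g)) ≡ ∑[ i < m ] f (g i)
  go {zero}  f g = refl
  go {suc m} f g = cong (f (g zero) +_) (go f (g ∘ suc))

eR≡∑pairCount : ∀ {n} (G : Graph n) → eR G ≡ ∑[ v < n ] pairCount (resolves G v)
eR≡∑pairCount {n} G =
  trans (#filter-concatMap _ _ (allFin n)) (trans (sumList-allFin {n} _) (sum-cong-≗ {n} λ v →
  trans (#filter-concatMap _ _ (allFin n)) (trans (sumList-allFin {n} _) (sum-cong-≗ {n} λ x →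
  trans (#filter-map _ _ (allFin n)) (sumList-allFin {n} _)))))

⟪_⟫ : ∀ {n} → (Fin n → Bool) → Subset n
⟪ χ ⟫ = Vec.tabulate χ

∣⟪⟫∣≡count : ∀ {n} (χ : Fin n → Bool) → ∣ ⟪ χ ⟫ ∣ ≡ count χ
∣⟪⟫∣≡count {zero}  χ = refl
∣⟪⟫∣≡count {suc n} χ with χ zero
... | true  = cong suc (∣⟪⟫∣≡count (χ ∘ suc))
... | false = ∣⟪⟫∣≡count (χ ∘ suc)

∈⟪⟫⇔T : ∀ {n} (χ : Fin n → Bool) w → w ∈ ⟪ χ ⟫ ⇔ T (χ w)
∈⟪⟫⇔T χ w = mk⇔
  (λ w∈ → Equivalence.from T-≡ (trans (sym (Vec.lookup∘tabulate χ w)) (Vec.[]=⇒lookup w∈)))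
  (λ χw → Vec.lookup⇒[]= w ⟪ χ ⟫ (trans (Vec.lookup∘tabulate χ w) (Equivalence.to T-≡ χw)))

module Resolution {n : ℕ} (G : Graph n) where

  unresolved⇒equidistant : ∀ {w x y} → ¬ T (resolves G w x y) → dist G w x ≡ dist G w y
  unresolved⇒equidistant ¬res = ≡ᵇ⇒≡ _ _ (subst T (not-involutive _) (¬T⇒T-not ¬res))

  equidistant⇒unresolved : ∀ {w x y} → dist G w x ≡ dist G w y → ¬ T (resolves G w x y)
  equidistant⇒unresolved eq res = T-not⇒¬T res (≡⇒≡ᵇ _ _ eq)

  Agree : (Fin n → Bool) → Fin n → Fin n → Set
  Agree χ x y = ∀ w → T (χ w) → dist G w x ≡ dist G w y

  agree? : ∀ χ x y → Dec (Agree χ x y)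
  agree? χ x y = all? (λ w → T? (χ w) →-dec (dist G w x ≟ dist G w y))

  agree-antitone : ∀ {χ χ′ x y} → χ ⊑ χ′ → Agree χ′ x y → Agree χ x y
  agree-antitone χ⊑χ′ agree w χw = agree w (χ⊑χ′ w χw)

  IsResolving : (Fin n → Bool) → Set
  IsResolving χ = ∀ x y → Agree χ x y → x ≡ y

  ⟪⟫-resolving : ∀ χ → Resolving G ⟪ χ ⟫ → IsResolving χ
  ⟪⟫-resolving χ res x y agree = res x y (λ w w∈χ → agree w (Equivalence.to (∈⟪⟫⇔T χ w) w∈χ))

  resolving-⟪⟫ : ∀ χ → IsResolving χ → Resolving G ⟪ χ ⟫
  resolving-⟪⟫ χ res x y agree = res x y (λ w χw → agree w (Equivalence.from (∈⟪⟫⇔T χ w) χw))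

  unresolvedPair : ∀ χ → ¬ IsResolving χ → ∃₂ λ x y → toℕ x < toℕ y × Agree χ x y
  unresolvedPair χ ¬res with any? (λ x → any? (λ y → (toℕ x <? toℕ y) ×-dec agree? χ x y))
  ... | yes (x , y , x<y , agree) = x , y , x<y , agree
  ... | no ∄pair = contradiction resolving ¬res
    where
    resolving : IsResolving χ
    resolving x y agree with <-cmp (toℕ x) (toℕ y)
    ... | tri< x<y _ _ = contradiction (x , y , x<y , agree) ∄pair
    ... | tri≈ _ x≡y _ = toℕ-injective x≡y
    ... | tri> _ _ y<x = contradiction (y , x , y<x , λ w χw → sym (agree w χw)) ∄pair

-- Graphs of metric dimension k: every vertex leaves ≥ k - 1 pairs unresolved

module MetricDimension {n k : ℕ} (G : Graph n) (β≡k : MetricDim G k) where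
  open Resolution G

  -- a basis has k of the n vertices
  k≤n : k ≤ n
  k≤n with proj₁ β≡k
  ... | B , _ , ∣B∣≡k = subst (_≤ n) ∣B∣≡k (∣p∣≤n B)

  small⇒¬resolving : ∀ χ → count χ < k → ¬ IsResolving χ
  small⇒¬resolving χ χ<k res =
    <⇒≱ χ<k (subst (k ≤_) (∣⟪⟫∣≡count χ) (proj₂ β≡k ⟪ χ ⟫ (resolving-⟪⟫ χ res)))

  someResolver : ∀ {x y} → x ≢ y → ∃ λ w → T (resolves G w x y)
  someResolver {x} {y} x≢y with any? (λ w → T? (resolves G w x y))
  ... | yes found = found
  ... | no none with proj₁ β≡k
  ...   | B , B-resolving , _ =
    contradiction (B-resolving x y (λ w _ → unresolved⇒equidistant (λ res → none (w , res)))) x≢y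

  Gain : Fin n → (Fin n → Bool) → Fin n → Fin n → Bool
  Gain v χ x y = not (resolves G v x y) ∧ isNo (agree? χ x y)

  Gain-intro : ∀ {v χ x y} → ¬ T (resolves G v x y) → ¬ Agree χ x y → T (Gain v χ x y)
  Gain-intro {v} {χ} {x} {y} unres sep with resolves G v x y | agree? χ x y
  ... | true  | _       = unres tt
  ... | false | yes agr = sep agr
  ... | false | no  _   = tt

  Gain-elim : ∀ {v χ x y} → T (Gain v χ x y) → ¬ T (resolves G v x y) × ¬ Agree χ x y
  Gain-elim {v} {χ} {x} {y} gain with resolves G v x y | agree? χ x y
  Gain-elim () | true  | _
  Gain-elim () | false | yes _
  Gain-elim _  | false | no ¬agr = (λ ()) , ¬agr

  gained : Fin n → (Fin n → Bool) → ℕ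
  gained v χ = pairCount (Gain v χ)

  gained-grows : ∀ {v χ χ′ x y} → χ ⊑ χ′ → T (χ v) → toℕ x < toℕ y →
    Agree χ x y → ¬ Agree χ′ x y → gained v χ < gained v χ′
  gained-grows {v} {χ} {χ′} {x} {y} χ⊑χ′ vχ x<y agree ¬agree′ =
    pairCount-mono-< {P = Gain v χ} {Q = Gain v χ′} still-gained x y x<y
      (λ gain → proj₂ (Gain-elim gain) agree)
      (Gain-intro (equidistant⇒unresolved (agree v vχ)) ¬agree′)
    where
    still-gained : ∀ x′ y′ → T (Gain v χ x′ y′) → T (Gain v χ′ x′ y′)
    still-gained x′ y′ gain with Gain-elim gain
    ... | unres , separated = Gain-intro unres (separated ∘ agree-antitone χ⊑χ′)

  grow : ∀ v χ → T (χ v) → count χ < k →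
    ∃ λ χ′ → T (χ′ v) × count χ′ ≡ suc (count χ) × gained v χ < gained v χ′
  grow v χ vχ χ<k with unresolvedPair χ (small⇒¬resolving χ χ<k)
  ... | x , y , x<y , agree with someResolver (<⇒≢ᶠ x<y)
  ...   | w , w-resolves = insert w χ , ⊑-insert w χ v vχ , count-insert χ w w∉χ
                         , gained-grows (⊑-insert w χ) vχ x<y agree ¬agree′
    where
    w∉χ : ¬ T (χ w)
    w∉χ wχ = equidistant⇒unresolved (agree w wχ) w-resolves
    ¬agree′ : ¬ Agree (insert w χ) x y
    ¬agree′ agree′ = equidistant⇒unresolved (agree′ w (∈-insert w χ)) w-resolves

  greedy : ∀ v j → j < k → ∃ λ χ → T (χ v) × count χ ≡ suc j × j ≤ gained v χ
  greedy v zero    _     = insert v ∅ , ∈-insert v ∅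
                         , trans (count-insert ∅ v (λ ())) (cong suc (count-∅ n)) , z≤n
  greedy v (suc j) 1+j<k with greedy v j (<⇒≤ 1+j<k)
  ... | χ , vχ , #χ , j≤gain with grow v χ vχ (subst (_< k) (sym #χ) 1+j<k)
  ...   | χ′ , vχ′ , #χ′ , gain< = χ′ , vχ′ , trans #χ′ (cong suc #χ) , ≤-trans (s≤s j≤gain) gain<

  unresolved-by-vertex : ∀ v → k ≤ suc (pairCount (λ x y → not (resolves G v x y)))
  unresolved-by-vertex v = below-all λ j j<k → case greedy v j j<k of λ where
    (χ , _ , _ , j≤gain) →
      ≤-trans j≤gain (pairCount-mono {P = Gain v χ} (λ x y → ¬T⇒T-not ∘ proj₁ ∘ Gain-elim))

  resolved-by-vertex : ∀ v → pairCount (resolves G v) ≤ n C 2 ∸ k + 1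
  resolved-by-vertex v =
    good-upper (trans (pairCount-complement (resolves G v)) (numPairs≡nC2 n)) (unresolved-by-vertex v)

-- Randomly k-dimensional graphs: every pair is resolved by ≥ n - k + 1 vertices

module RandomlyDimensional {n k : ℕ} (G : Graph n) (random : RandomlyDim G k) where
  open Resolution G
  open MetricDimension G (proj₁ random) using (k≤n)

  size-k⇒resolving : ∀ χ → count χ ≡ k → IsResolving χ
  size-k⇒resolving χ #χ = ⟪⟫-resolving χ (proj₂ random ⟪ χ ⟫ (trans (∣⟪⟫∣≡count χ) #χ))

  -- The non-resolvers of a pair form a non-resolving set, so fewer than k of them.
  few-non-resolvers : ∀ {x y} → toℕ x < toℕ y → count (λ w → not (resolves G w x y)) < k
  few-non-resolvers {x} {y} x<y with k ≤? count (λ w → not (resolves G w x y))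
  ... | no k≰ = ≰⇒> k≰
  ... | yes k≤ with pick k (λ w → not (resolves G w x y)) k≤
  ...   | χ , χ⊑N , #χ = contradiction
    (size-k⇒resolving χ #χ x y (λ w χw → unresolved⇒equidistant (T-not⇒¬T (χ⊑N w χw))))
    (<⇒≢ᶠ x<y)

  many-resolvers : ∀ x y → toℕ x < toℕ y → n ∸ k + 1 ≤ count (λ w → resolves G w x y)
  many-resolvers x y x<y =
    good-lower (count-complement (λ w → resolves G w x y)) (few-non-resolvers x<y) k≤n

mainTheorem7 : (n k : ℕ) (G : Graph n) → Connected G → RandomlyDim G k →
    ((n C 2) * (n ∸ k + 1) ≤ eR G) × (eR G ≤ n * ((n C 2) ∸ k + 1))
mainTheorem7 n k G _ random = lower , upper
  where
  open RandomlyDimensional G random using (many-resolvers)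
  open MetricDimension G (proj₁ random) using (resolved-by-vertex)
  open ≤-Reasoning

  lower : (n C 2) * (n ∸ k + 1) ≤ eR G
  lower = begin
    (n C 2) * (n ∸ k + 1)               ≤⟨ incidences-lower (resolves G) (n ∸ k + 1) many-resolvers ⟩
    ∑[ v < n ] pairCount (resolves G v) ≡⟨ eR≡∑pairCount G ⟨
    eR G                                ∎

  upper : eR G ≤ n * ((n C 2) ∸ k + 1)
  upper = begin
    eR G                                ≡⟨ eR≡∑pairCount G ⟩
    ∑[ v < n ] pairCount (resolves G v) ≤⟨ ∑-mono-≤ resolved-by-vertex ⟩
    ∑[ v < n ] ((n C 2) ∸ k + 1)        ≡⟨ ∑-const n ((n C 2) ∸ k + 1) ⟩
    n * ((n C 2) ∸ k + 1)               ∎
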